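{- Let $q \ge 1$ be an integer and let $\Gamma = \langle Z, D\rangle$ be a $q$-uniform hypergraph with finite vertex set $Z$ and finite edge set $D$. For $B \subseteq Z$, let $K_B$ be the bipartite graph with vertex classes $D$ and $Z \setminus B$ in which $a \in D$ is adjacent to $z \in Z\setminus B$ iff $z \in \Gamma a$. Then the following are equivalent: (i) for every set $B \subseteq Z$ with $|B| = q-1$, the bipartite graph $K_B$ has a matching saturating every vertex of $D$; (ii) $\Gamma$ is a hyperforest, i.e. $|\Gamma A| - q + 1 \ge |A|$ for every nonempty $A \subseteq D$. -}

module Defs where

open import Data.Nat using (ℕ)
open import Data.Fin using (Fin)
open import Data.Fin.Subset using (Subset; ⋃; _∈_; _∉_)
open import Data.Fin.Subset.Properties using (_∈?_)
open import Data.List using (map; filter; allFin)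
open import Data.Product using (Σ; _×_)
open import Relation.Binary.PropositionalEquality using (_≡_)
open import Function.Definitions using (Injective)

-- A hypergraph Γ = ⟨Z, D⟩ with Z = Fin n, D = Fin m, given by its incidence
-- map  a ↦ Γ a ⊆ Z.

image : ∀ {m n} → (Fin m → Subset n) → Subset m → Subset n
image {m} Γ A = ⋃ (map Γ (filter (_∈? A) (allFin m)))

-- A matching of the bipartite graph K_B (classes D and Z \ B, a ~ z iff
-- z ∈ Γ a) saturating every vertex of D: an injective choice of a
-- neighbour in Z \ B for every edge a ∈ D.
SaturatingMatching : ∀ {m n} → (Fin m → Subset n) → Subset n → Set
SaturatingMatching {m} {n} Γ B =
  Σ (Fin m → Fin n) λ f →
    Injective _≡_ _≡_ f × (∀ a → f a ∈ Γ a × f a ∉ B)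

-- (i) ⇒ (ii): given a ∈ A, pick x ∈ Γ a. The set B = Γ a ∖ {x} has q − 1
-- elements and lies inside Γ A, while a matching of K_B injects A into
-- Γ A ∖ B; hence |Γ A| ≥ |A| + q − 1.
--
-- (ii) ⇒ (i): for |B| = q − 1 the sets Γ a ∖ B satisfy Hall's condition, since
-- |⋃_{a∈A} (Γ a ∖ B)| ≥ |Γ A| − (q − 1) ≥ |A|, and a matching saturating D is
-- exactly a system of distinct representatives of them.
--
-- Hall's theorem follows Rado's argument: while some S a has two elements
-- x ≠ y, removing x or removing y from S a preserves Hall's condition. Indeed,
-- deficient sets A, A′ for the two removals both contain a, and by
-- inclusion–exclusion A ∪ A′ or (A ∩ A′) ∖ {a} would be deficient for S.
-- Once every S a is a singleton, Hall's condition makes them distinct.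

module Submission where

open import Defs
open import Data.Nat using (ℕ; zero; suc; _≥_; _+_; _∸_; _≤_; _<_; z≤n; s≤s; _≤?_; _<?_)
open import Data.Nat.Properties
  using (≤-refl; 1+n≰n; ≤-trans; ≤-reflexive; ≤-<-trans; <⇒≱; ≮⇒≥; ≰⇒>; >⇒≢; m≤m+n; +-suc; +-comm;
         +-mono-≤; +-mono-<-≤; +-mono-≤-<; +-cancelˡ-≤; +-cancelʳ-≤; +-∸-assoc; module ≤-Reasoning)
open import Data.Nat.Induction using (<-wellFounded)
open import Induction.WellFounded using (Acc; acc)
open import Data.Bool using (true; false)
open import Data.Fin using (Fin; zero; suc; _≟_)
open import Data.Fin.Properties using (any?; suc-injective)
open import Data.Fin.Subset hiding (⊥)
open import Data.Fin.Subset.Properties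
open import Data.Vec using ([]; _∷_; here; there)
open import Data.Vec.Functional using (updateAt)
open import Data.Vec.Functional.Properties using (updateAt-updates; updateAt-minimal)
open import Data.List using (List; []; _∷_; map; filter; allFin)
import Data.List.Relation.Unary.Any as Any
import Data.List.Membership.Propositional as List
open import Data.List.Membership.Propositional.Properties
  using (∈-allFin; ∈-map∘filter⁻; ∈-map∘filter⁺)
open import Data.Product using (Σ; ∃; ∃₂; _×_; _,_; proj₁; proj₂)
open import Data.Sum using (_⊎_; inj₁; inj₂; [_,_]′)
open import Relation.Nullary using (¬_; Dec; yes; no; contradiction)
open import Relation.Binary.PropositionalEquality
open import Function using (_∘_)
open import Function.Definitions using (Injective)

x∈p─q⇒x∉q : ∀ {n} {x : Fin n} (p q : Subset n) → x ∈ p ─ q → x ∉ q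
x∈p─q⇒x∉q {x = zero}  (true  ∷ p) (false ∷ q) here      = λ ()
x∈p─q⇒x∉q {x = zero}  (true  ∷ p) (true  ∷ q) ()
x∈p─q⇒x∉q {x = zero}  (false ∷ p) (true  ∷ q) ()
x∈p─q⇒x∉q {x = zero}  (false ∷ p) (false ∷ q) ()
x∈p─q⇒x∉q {x = suc x} (_     ∷ p) (_     ∷ q) (there i) = λ { (there j) → x∈p─q⇒x∉q p q i j }

∣p─q∣+∣q∣≡∣p∣ : ∀ {n} {p q : Subset n} → q ⊆ p → ∣ p ─ q ∣ + ∣ q ∣ ≡ ∣ p ∣
∣p─q∣+∣q∣≡∣p∣ {p = []}        {[]}        _   = refl
∣p─q∣+∣q∣≡∣p∣ {p = true  ∷ p} {true  ∷ q} q⊆p =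
  trans (+-suc ∣ p ─ q ∣ ∣ q ∣) (cong suc (∣p─q∣+∣q∣≡∣p∣ (drop-∷-⊆ q⊆p)))
∣p─q∣+∣q∣≡∣p∣ {p = true  ∷ p} {false ∷ q} q⊆p = cong suc (∣p─q∣+∣q∣≡∣p∣ (drop-∷-⊆ q⊆p))
∣p─q∣+∣q∣≡∣p∣ {p = false ∷ p} {false ∷ q} q⊆p = ∣p─q∣+∣q∣≡∣p∣ (drop-∷-⊆ q⊆p)
∣p─q∣+∣q∣≡∣p∣ {p = false ∷ p} {true  ∷ q} q⊆p with () ← q⊆p here

x∈p⇒suc∣p-x∣≡∣p∣ : ∀ {n} {x : Fin n} {p : Subset n} → x ∈ p → suc ∣ p - x ∣ ≡ ∣ p ∣
x∈p⇒suc∣p-x∣≡∣p∣ {x = x} {p} x∈p = begin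
  suc ∣ p - x ∣          ≡⟨ +-comm 1 ∣ p - x ∣ ⟩
  ∣ p - x ∣ + 1          ≡⟨ cong (∣ p - x ∣ +_) (∣⁅x⁆∣≡1 x) ⟨
  ∣ p - x ∣ + ∣ ⁅ x ⁆ ∣  ≡⟨ ∣p─q∣+∣q∣≡∣p∣ (λ y∈⁅x⁆ → subst (_∈ p) (sym (x∈⁅y⁆⇒x≡y x y∈⁅x⁆)) x∈p) ⟩
  ∣ p ∣                  ∎
  where open ≡-Reasoning

∣p∪q∣+∣p∩q∣≡∣p∣+∣q∣ : ∀ {n} (p q : Subset n) → ∣ p ∪ q ∣ + ∣ p ∩ q ∣ ≡ ∣ p ∣ + ∣ q ∣
∣p∪q∣+∣p∩q∣≡∣p∣+∣q∣ []          []          = refl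
∣p∪q∣+∣p∩q∣≡∣p∣+∣q∣ (true  ∷ p) (true  ∷ q) = cong suc (begin
  ∣ p ∪ q ∣ + suc ∣ p ∩ q ∣  ≡⟨ +-suc ∣ p ∪ q ∣ ∣ p ∩ q ∣ ⟩
  suc (∣ p ∪ q ∣ + ∣ p ∩ q ∣) ≡⟨ cong suc (∣p∪q∣+∣p∩q∣≡∣p∣+∣q∣ p q) ⟩
  suc (∣ p ∣ + ∣ q ∣)         ≡⟨ +-suc ∣ p ∣ ∣ q ∣ ⟨
  ∣ p ∣ + suc ∣ q ∣           ∎)
  where open ≡-Reasoning
∣p∪q∣+∣p∩q∣≡∣p∣+∣q∣ (true  ∷ p) (false ∷ q) = cong suc (∣p∪q∣+∣p∩q∣≡∣p∣+∣q∣ p q)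
∣p∪q∣+∣p∩q∣≡∣p∣+∣q∣ (false ∷ p) (true  ∷ q) =
  trans (cong suc (∣p∪q∣+∣p∩q∣≡∣p∣+∣q∣ p q)) (sym (+-suc ∣ p ∣ ∣ q ∣))
∣p∪q∣+∣p∩q∣≡∣p∣+∣q∣ (false ∷ p) (false ∷ q) = ∣p∪q∣+∣p∩q∣≡∣p∣+∣q∣ p q

∣p∪q∣≤∣p∣+∣q∣ : ∀ {n} (p q : Subset n) → ∣ p ∪ q ∣ ≤ ∣ p ∣ + ∣ q ∣
∣p∪q∣≤∣p∣+∣q∣ p q = subst (∣ p ∪ q ∣ ≤_) (∣p∪q∣+∣p∩q∣≡∣p∣+∣q∣ p q) (m≤m+n ∣ p ∪ q ∣ ∣ p ∩ q ∣)

Empty⇒∣p∣≡0 : ∀ {n} {p : Subset n} → Empty p → ∣ p ∣ ≡ 0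
Empty⇒∣p∣≡0 {n} empty = trans (cong ∣_∣ (Empty-unique empty)) (∣⊥∣≡0 n)

0<∣p∣⇒Nonempty : ∀ {n} (p : Subset n) → 0 < ∣ p ∣ → Nonempty p
0<∣p∣⇒Nonempty p 0<∣p∣ with nonempty? p
... | yes nonempty = nonempty
... | no  empty    = contradiction (Empty⇒∣p∣≡0 empty) (>⇒≢ 0<∣p∣)

x∈p⇒0<∣p∣ : ∀ {n} {x : Fin n} {p : Subset n} → x ∈ p → 0 < ∣ p ∣
x∈p⇒0<∣p∣ x∈p = ≤-<-trans z≤n (x∈p⇒∣p-x∣<∣p∣ x∈p)

x∈p∧y∈p∧x≢y⇒2≤∣p∣ : ∀ {n} {x y : Fin n} {p : Subset n} → x ∈ p → y ∈ p → x ≢ y → 2 ≤ ∣ p ∣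
x∈p∧y∈p∧x≢y⇒2≤∣p∣ x∈p y∈p x≢y =
  ≤-trans (s≤s (x∈p⇒0<∣p∣ (x∈p∧x≢y⇒x∈p-y x∈p x≢y))) (x∈p⇒∣p-x∣<∣p∣ y∈p)

2≤∣p∣⇒distinct : ∀ {n} (p : Subset n) → 2 ≤ ∣ p ∣ → ∃₂ λ x y → x ∈ p × y ∈ p × x ≢ y
2≤∣p∣⇒distinct p 2≤∣p∣ with 0<∣p∣⇒Nonempty p (≤-trans (s≤s z≤n) 2≤∣p∣)
... | x , x∈p
  with 0<∣p∣⇒Nonempty (p - x) (+-cancelˡ-≤ 1 1 _ (subst (2 ≤_) (sym (x∈p⇒suc∣p-x∣≡∣p∣ x∈p)) 2≤∣p∣))
... | y , y∈p-x =
  x , y , x∈p , p─q⊆p p ⁅ x ⁆ y∈p-x , λ x≡y → x∉⁅y⁆⇒x≢y (x∈p─q⇒x∉q p ⁅ x ⁆ y∈p-x) (sym x≡y)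

∣p∣<2⇒p⊆⁅x⁆ : ∀ {n} {x : Fin n} {p : Subset n} → ∣ p ∣ < 2 → x ∈ p → p ⊆ ⁅ x ⁆
∣p∣<2⇒p⊆⁅x⁆ {x = x} ∣p∣<2 x∈p {y} y∈p with y ≟ x
... | yes refl = x∈⁅x⁆ x
... | no  y≢x  = contradiction (x∈p∧y∈p∧x≢y⇒2≤∣p∣ y∈p x∈p y≢x) (<⇒≱ ∣p∣<2)

injective⇒∣p∣≤∣q∣ : ∀ {m n} {f : Fin m → Fin n} → Injective _≡_ _≡_ f →
  (p : Subset m) (q : Subset n) → (∀ {a} → a ∈ p → f a ∈ q) → ∣ p ∣ ≤ ∣ q ∣
injective⇒∣p∣≤∣q∣ f-inj []          q p↦q = z≤n
injective⇒∣p∣≤∣q∣ f-inj (false ∷ p) q p↦q =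
  injective⇒∣p∣≤∣q∣ (suc-injective ∘ f-inj) p q (p↦q ∘ there)
injective⇒∣p∣≤∣q∣ {f = f} f-inj (true ∷ p) q p↦q = begin
  suc ∣ p ∣              ≤⟨ s≤s (injective⇒∣p∣≤∣q∣ (suc-injective ∘ f-inj) p (q - f zero) p↦q-f0) ⟩
  suc ∣ q - f zero ∣     ≡⟨ x∈p⇒suc∣p-x∣≡∣p∣ (p↦q here) ⟩
  ∣ q ∣                  ∎
  where
  open ≤-Reasoning
  p↦q-f0 : ∀ {a} → a ∈ p → f (suc a) ∈ q - f zero
  p↦q-f0 a∈p = x∈p∧x≢y⇒x∈p-y (p↦q (there a∈p)) (λ eq → contradiction (f-inj eq) λ ())

x∈⋃⁺ : ∀ {n} {x : Fin n} {p : Subset n} {ps : List (Subset n)} → p List.∈ ps → x ∈ p → x ∈ ⋃ ps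
x∈⋃⁺ (Any.here refl) x∈p = x∈p∪q⁺ (inj₁ x∈p)
x∈⋃⁺ (Any.there p∈ps) x∈p = x∈p∪q⁺ (inj₂ (x∈⋃⁺ p∈ps x∈p))

x∈⋃⁻ : ∀ {n} {x : Fin n} (ps : List (Subset n)) → x ∈ ⋃ ps → ∃ λ p → p List.∈ ps × x ∈ p
x∈⋃⁻ []       x∈⊥ = contradiction x∈⊥ ∉⊥
x∈⋃⁻ (p ∷ ps) x∈⋃ with x∈p∪q⁻ p (⋃ ps) x∈⋃
... | inj₁ x∈p = p , Any.here refl , x∈p
... | inj₂ x∈⋃ps with x∈⋃⁻ ps x∈⋃ps
... | r , r∈ps , x∈r = r , Any.there r∈ps , x∈r

module _ {m n} (S : Fin m → Subset n) where

  ∈-image⁺ : ∀ {A a z} → a ∈ A → z ∈ S a → z ∈ image S A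
  ∈-image⁺ {A} {a} a∈A z∈Sa =
    x∈⋃⁺ (∈-map∘filter⁺ S (_∈? A) {f = S} (a , ∈-allFin a , refl , a∈A)) z∈Sa

  ∈-image⁻ : ∀ A {z} → z ∈ image S A → ∃ λ a → a ∈ A × z ∈ S a
  ∈-image⁻ A z∈SA with x∈⋃⁻ (map S (filter (_∈? A) (allFin m))) z∈SA
  ... | _ , Sa∈ , z∈Sa with ∈-map∘filter⁻ S (_∈? A) {f = S} {xs = allFin m} Sa∈
  ... | a , _ , refl , a∈A = a , a∈A , z∈Sa

  image-⊆ : ∀ A {T : Subset n} → (∀ {a} → a ∈ A → S a ⊆ T) → image S A ⊆ T
  image-⊆ A Sa⊆T z∈SA with ∈-image⁻ A z∈SA
  ... | a , a∈A , z∈Sa = Sa⊆T a∈A z∈Sa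

image⁅a⁆⊆ : ∀ {m n} (S : Fin m → Subset n) (a : Fin m) → image S ⁅ a ⁆ ⊆ S a
image⁅a⁆⊆ S a = image-⊆ S ⁅ a ⁆ λ b∈⁅a⁆ →
  subst (λ b → S b ⊆ S a) (sym (x∈⁅y⁆⇒x≡y a b∈⁅a⁆)) (λ z∈Sa → z∈Sa)

-- Hall's theorem

HallCondition : ∀ {m n} → (Fin m → Subset n) → Set
HallCondition {m} S = ∀ (A : Subset m) → ∣ A ∣ ≤ ∣ image S A ∣

Deficient : ∀ {m n} → (Fin m → Subset n) → Subset m → Set
Deficient S A = ∣ image S A ∣ < ∣ A ∣

DistinctRepresentatives : ∀ {m n} → (Fin m → Subset n) → Set
DistinctRepresentatives {m} {n} S =
  Σ (Fin m → Fin n) λ f → Injective _≡_ _≡_ f × (∀ a → f a ∈ S a)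

hall⊎deficient : ∀ {m n} (S : Fin m → Subset n) → HallCondition S ⊎ ∃ (Deficient S)
hall⊎deficient S with anySubset? (λ A → ∣ image S A ∣ <? ∣ A ∣)
... | yes deficient    = inj₂ deficient
... | no  ¬deficient   = inj₁ λ A → ≮⇒≥ λ d → ¬deficient (A , d)

representatives-mono : ∀ {m n} {S T : Fin m → Subset n} → (∀ a → S a ⊆ T a) →
  DistinctRepresentatives S → DistinctRepresentatives T
representatives-mono S⊆T (f , f-inj , f∈S) = f , f-inj , λ a → S⊆T a (f∈S a)

totalSize : ∀ {m n} → (Fin m → Subset n) → ℕ
totalSize {zero}  S = 0
totalSize {suc m} S = ∣ S zero ∣ + totalSize (S ∘ suc)

totalSize-mono-≤ : ∀ {m n} {S T : Fin m → Subset n} → (∀ b → ∣ T b ∣ ≤ ∣ S b ∣) →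
  totalSize T ≤ totalSize S
totalSize-mono-≤ {zero}  T≤S = z≤n
totalSize-mono-≤ {suc m} T≤S = +-mono-≤ (T≤S zero) (totalSize-mono-≤ (T≤S ∘ suc))

totalSize-mono-< : ∀ {m n} {S T : Fin m → Subset n} (a : Fin m) → (∀ b → ∣ T b ∣ ≤ ∣ S b ∣) →
  ∣ T a ∣ < ∣ S a ∣ → totalSize T < totalSize S
totalSize-mono-< zero    T≤S Ta<Sa = +-mono-<-≤ Ta<Sa (totalSize-mono-≤ (T≤S ∘ suc))
totalSize-mono-< (suc a) T≤S Ta<Sa = +-mono-≤-< (T≤S zero) (totalSize-mono-< a (T≤S ∘ suc) Ta<Sa)

remove : ∀ {m n} → (Fin m → Subset n) → Fin m → Fin n → Fin m → Subset n
remove S a x = updateAt S a (_- x)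

module _ {m n} (S : Fin m → Subset n) (a : Fin m) (x : Fin n) where

  remove-⊆ : ∀ b → remove S a x b ⊆ S b
  remove-⊆ b {z} with b ≟ a
  ... | yes refl = p─q⊆p (S b) ⁅ x ⁆ ∘ subst (z ∈_) (updateAt-updates b S)
  ... | no  b≢a  = subst (z ∈_) (updateAt-minimal b a S b≢a)

  ∈-remove-≢ : ∀ {b z} → b ≢ a → z ∈ S b → z ∈ remove S a x b
  ∈-remove-≢ {b} {z} b≢a = subst (z ∈_) (sym (updateAt-minimal b a S b≢a))

  ∈-remove-self : ∀ {z} → z ∈ S a → z ≢ x → z ∈ remove S a x a
  ∈-remove-self {z} z∈Sa z≢x = subst (z ∈_) (sym (updateAt-updates a S)) (x∈p∧x≢y⇒x∈p-y z∈Sa z≢x)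

  totalSize-remove-< : x ∈ S a → totalSize (remove S a x) < totalSize S
  totalSize-remove-< x∈Sa = totalSize-mono-< a (p⊆q⇒∣p∣≤∣q∣ ∘ remove-⊆)
    (subst (λ r → ∣ r ∣ < ∣ S a ∣) (sym (updateAt-updates a S)) (x∈p⇒∣p-x∣<∣p∣ x∈Sa))

module _ {m n} {S : Fin m → Subset n} (hall : HallCondition S) {a : Fin m} where

  deficient-remove⇒∈ : ∀ {x A} → Deficient (remove S a x) A → a ∈ A
  deficient-remove⇒∈ {x} {A} deficient with a ∈? A
  ... | yes a∈A = a∈A
  ... | no  a∉A = contradiction (≤-trans (hall A) (p⊆q⇒∣p∣≤∣q∣ SA⊆S′A)) (<⇒≱ deficient)
    where
    SA⊆S′A : image S A ⊆ image (remove S a x) A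
    SA⊆S′A = image-⊆ S A λ b∈A → ∈-image⁺ (remove S a x) b∈A ∘ ∈-remove-≢ S a x λ { refl → a∉A b∈A }

  removals-not-both-deficient : ∀ {x y A A′} → x ≢ y →
    ¬ (Deficient (remove S a x) A × Deficient (remove S a y) A′)
  removals-not-both-deficient {x} {y} {A} {A′} x≢y (deficient , deficient′) = 1+n≰n bound
    where
    a∈A : a ∈ A
    a∈A = deficient-remove⇒∈ deficient
    a∈A′ : a ∈ A′
    a∈A′ = deficient-remove⇒∈ deficient′
    X Y I : Subset _
    X = image (remove S a x) A
    Y = image (remove S a y) A′
    I = (A ∩ A′) - a

    S[A∪A′]⊆X∪Y : image S (A ∪ A′) ⊆ X ∪ Y
    S[A∪A′]⊆X∪Y = image-⊆ S (A ∪ A′) λ {b} b∈A∪A′ {z} z∈Sb →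
      x∈p∪q⁺ (go b∈A∪A′ z∈Sb (b ≟ a) (z ≟ x))
      where
      go : ∀ {b z} → b ∈ A ∪ A′ → z ∈ S b → Dec (b ≡ a) → Dec (z ≡ x) → z ∈ X ⊎ z ∈ Y
      go b∈A∪A′ z∈Sb (no b≢a) _ with x∈p∪q⁻ A A′ b∈A∪A′
      ... | inj₁ b∈A  = inj₁ (∈-image⁺ (remove S a x) b∈A  (∈-remove-≢ S a x b≢a z∈Sb))
      ... | inj₂ b∈A′ = inj₂ (∈-image⁺ (remove S a y) b∈A′ (∈-remove-≢ S a y b≢a z∈Sb))
      go _ z∈Sa (yes refl) (yes refl) =
        inj₂ (∈-image⁺ (remove S a y) a∈A′ (∈-remove-self S a y z∈Sa x≢y))
      go _ z∈Sa (yes refl) (no z≢x)   =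
        inj₁ (∈-image⁺ (remove S a x) a∈A  (∈-remove-self S a x z∈Sa z≢x))

    S[I]⊆X∩Y : image S I ⊆ X ∩ Y
    S[I]⊆X∩Y = image-⊆ S I λ {b} b∈I z∈Sb →
      let b≢a       = x∉⁅y⁆⇒x≢y (x∈p─q⇒x∉q (A ∩ A′) ⁅ a ⁆ b∈I)
          b∈A , b∈A′ = x∈p∩q⁻ A A′ (p─q⊆p (A ∩ A′) ⁅ a ⁆ b∈I)
      in x∈p∩q⁺ (∈-image⁺ (remove S a x) b∈A (∈-remove-≢ S a x b≢a z∈Sb) ,
                 ∈-image⁺ (remove S a y) b∈A′ (∈-remove-≢ S a y b≢a z∈Sb))

    1+∣I∣≡∣A∩A′∣ : 1 + ∣ I ∣ ≡ ∣ A ∩ A′ ∣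
    1+∣I∣≡∣A∩A′∣ = x∈p⇒suc∣p-x∣≡∣p∣ (x∈p∩q⁺ (a∈A , a∈A′))

    open ≤-Reasoning
    bound : 2 + (∣ X ∣ + ∣ Y ∣) ≤ 1 + (∣ X ∣ + ∣ Y ∣)
    bound = begin
      2 + (∣ X ∣ + ∣ Y ∣)                     ≡⟨ cong suc (+-suc ∣ X ∣ ∣ Y ∣) ⟨
      suc ∣ X ∣ + suc ∣ Y ∣                   ≤⟨ +-mono-≤ deficient deficient′ ⟩
      ∣ A ∣ + ∣ A′ ∣                          ≡⟨ ∣p∪q∣+∣p∩q∣≡∣p∣+∣q∣ A A′ ⟨
      ∣ A ∪ A′ ∣ + ∣ A ∩ A′ ∣                 ≡⟨ cong (∣ A ∪ A′ ∣ +_) 1+∣I∣≡∣A∩A′∣ ⟨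
      ∣ A ∪ A′ ∣ + suc ∣ I ∣                  ≡⟨ +-suc ∣ A ∪ A′ ∣ ∣ I ∣ ⟩
      1 + (∣ A ∪ A′ ∣ + ∣ I ∣)                ≤⟨ s≤s (+-mono-≤ (hall (A ∪ A′)) (hall I)) ⟩
      1 + (∣ image S (A ∪ A′) ∣ + ∣ image S I ∣)
        ≤⟨ s≤s (+-mono-≤ (p⊆q⇒∣p∣≤∣q∣ S[A∪A′]⊆X∪Y) (p⊆q⇒∣p∣≤∣q∣ S[I]⊆X∩Y)) ⟩
      1 + (∣ X ∪ Y ∣ + ∣ X ∩ Y ∣)             ≡⟨ cong suc (∣p∪q∣+∣p∩q∣≡∣p∣+∣q∣ X Y) ⟩
      1 + (∣ X ∣ + ∣ Y ∣)                     ∎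

  hall-remove-one-of : ∀ {x y} → x ≢ y →
    HallCondition (remove S a x) ⊎ HallCondition (remove S a y)
  hall-remove-one-of {x} {y} x≢y with hall⊎deficient (remove S a x) | hall⊎deficient (remove S a y)
  ... | inj₁ hall-x       | _                  = inj₁ hall-x
  ... | inj₂ _            | inj₁ hall-y        = inj₂ hall-y
  ... | inj₂ (A , def-x)  | inj₂ (A′ , def-y)  =
    contradiction (def-x , def-y) (removals-not-both-deficient x≢y)

hall-singletons : ∀ {m n} {S : Fin m → Subset n} → HallCondition S → (∀ a → ∣ S a ∣ < 2) →
  DistinctRepresentatives S
hall-singletons {m} {n} {S} hall small = rep , rep-injective , rep∈S
  where
  nonempty : ∀ a → Nonempty (S a)
  nonempty a = 0<∣p∣⇒Nonempty (S a) (begin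
    1                    ≡⟨ ∣⁅x⁆∣≡1 a ⟨
    ∣ ⁅ a ⁆ ∣            ≤⟨ hall ⁅ a ⁆ ⟩
    ∣ image S ⁅ a ⁆ ∣    ≤⟨ p⊆q⇒∣p∣≤∣q∣ (image⁅a⁆⊆ S a) ⟩
    ∣ S a ∣              ∎)
    where open ≤-Reasoning
  rep : Fin m → Fin n
  rep a = proj₁ (nonempty a)
  rep∈S : ∀ a → rep a ∈ S a
  rep∈S a = proj₂ (nonempty a)

  rep-injective : Injective _≡_ _≡_ rep
  rep-injective {a} {b} rep-a≡rep-b with a ≟ b
  ... | yes a≡b = a≡b
  ... | no  a≢b =
    contradiction (≤-trans (hall (⁅ a ⁆ ∪ ⁅ b ⁆)) (p⊆q⇒∣p∣≤∣q∣ S[a,b]⊆⁅rep-a⁆)) (<⇒≱ 1<2)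
    where
    1<2 : ∣ ⁅ rep a ⁆ ∣ < ∣ ⁅ a ⁆ ∪ ⁅ b ⁆ ∣
    1<2 = subst (_< _) (sym (∣⁅x⁆∣≡1 (rep a)))
            (x∈p∧y∈p∧x≢y⇒2≤∣p∣ (x∈p∪q⁺ (inj₁ (x∈⁅x⁆ a))) (x∈p∪q⁺ (inj₂ (x∈⁅x⁆ b))) a≢b)
    S[a,b]⊆⁅rep-a⁆ : image S (⁅ a ⁆ ∪ ⁅ b ⁆) ⊆ ⁅ rep a ⁆
    S[a,b]⊆⁅rep-a⁆ = image-⊆ S (⁅ a ⁆ ∪ ⁅ b ⁆) λ c∈ → case (x∈p∪q⁻ ⁅ a ⁆ ⁅ b ⁆ c∈)
      where
      case : ∀ {c} → c ∈ ⁅ a ⁆ ⊎ c ∈ ⁅ b ⁆ → S c ⊆ ⁅ rep a ⁆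
      case (inj₁ c∈⁅a⁆) rewrite x∈⁅y⁆⇒x≡y a c∈⁅a⁆ = ∣p∣<2⇒p⊆⁅x⁆ (small a) (rep∈S a)
      case (inj₂ c∈⁅b⁆) rewrite x∈⁅y⁆⇒x≡y b c∈⁅b⁆ | rep-a≡rep-b = ∣p∣<2⇒p⊆⁅x⁆ (small b) (rep∈S b)

hall-theorem : ∀ {m n} (S : Fin m → Subset n) → HallCondition S → DistinctRepresentatives S
hall-theorem S = go S (<-wellFounded (totalSize S))
  where
  go : ∀ {m n} (S : Fin m → Subset n) → Acc _<_ (totalSize S) →
    HallCondition S → DistinctRepresentatives S
  go S (acc smaller) hall with any? (λ a → 2 ≤? ∣ S a ∣)
  ... | no  none       = hall-singletons hall λ a → ≰⇒> λ 2≤ → none (a , 2≤)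
  ... | yes (a , 2≤∣Sa∣) = shrink-one (2≤∣p∣⇒distinct (S a) 2≤∣Sa∣)
    where
    shrink : ∀ {x} → x ∈ S a → HallCondition (remove S a x) → DistinctRepresentatives S
    shrink x∈Sa hall′ =
      representatives-mono (remove-⊆ S a _) (go _ (smaller (totalSize-remove-< S a _ x∈Sa)) hall′)
    shrink-one : (∃₂ λ x y → x ∈ S a × y ∈ S a × x ≢ y) → DistinctRepresentatives S
    shrink-one (x , y , x∈Sa , y∈Sa , x≢y) =
      [ shrink x∈Sa , shrink y∈Sa ]′ (hall-remove-one-of hall x≢y)

-- Matchings and hyperforests

Hyperforest : ∀ {m n} → ℕ → (Fin m → Subset n) → Set
Hyperforest {m} q Γ = ∀ (A : Subset m) → Nonempty A → ∣ image Γ A ∣ ≥ ∣ A ∣ + q ∸ 1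

matching⇒∣A∣+∣B∣≤∣ΓA∣ : ∀ {m n} {Γ : Fin m → Subset n} {B : Subset n} → SaturatingMatching Γ B →
  ∀ A → B ⊆ image Γ A → ∣ A ∣ + ∣ B ∣ ≤ ∣ image Γ A ∣
matching⇒∣A∣+∣B∣≤∣ΓA∣ {Γ = Γ} {B} (f , f-inj , f∈Γ∖B) A B⊆ΓA = begin
  ∣ A ∣ + ∣ B ∣                ≤⟨ +-mono-≤ (injective⇒∣p∣≤∣q∣ f-inj A (image Γ A ─ B) A↦ΓA∖B) ≤-refl ⟩
  ∣ image Γ A ─ B ∣ + ∣ B ∣    ≡⟨ ∣p─q∣+∣q∣≡∣p∣ B⊆ΓA ⟩
  ∣ image Γ A ∣                ∎
  where
  open ≤-Reasoning
  A↦ΓA∖B : ∀ {a} → a ∈ A → f a ∈ image Γ A ─ B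
  A↦ΓA∖B {a} a∈A = x∈p∧x∉q⇒x∈p─q (∈-image⁺ Γ a∈A (proj₁ (f∈Γ∖B a))) (proj₂ (f∈Γ∖B a))

matchings⇒hyperforest : ∀ {q m n} {Γ : Fin m → Subset n} → q ≥ 1 → (∀ a → ∣ Γ a ∣ ≡ q) →
  (∀ (B : Subset n) → ∣ B ∣ ≡ q ∸ 1 → SaturatingMatching Γ B) → Hyperforest q Γ
matchings⇒hyperforest {q} {Γ = Γ} q≥1 ∣Γ∣≡q matchings A (a , a∈A)
  with 0<∣p∣⇒Nonempty (Γ a) (subst (0 <_) (sym (∣Γ∣≡q a)) q≥1)
... | x , x∈Γa = begin
  ∣ A ∣ + q ∸ 1           ≡⟨ +-∸-assoc ∣ A ∣ q≥1 ⟩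
  ∣ A ∣ + (q ∸ 1)         ≡⟨ cong (∣ A ∣ +_) ∣B∣≡q∸1 ⟨
  ∣ A ∣ + ∣ Γ a - x ∣     ≤⟨ matching⇒∣A∣+∣B∣≤∣ΓA∣ (matchings (Γ a - x) ∣B∣≡q∸1) A B⊆ΓA ⟩
  ∣ image Γ A ∣           ∎
  where
  open ≤-Reasoning
  ∣B∣≡q∸1 : ∣ Γ a - x ∣ ≡ q ∸ 1
  ∣B∣≡q∸1 = cong (_∸ 1) (trans (x∈p⇒suc∣p-x∣≡∣p∣ x∈Γa) (∣Γ∣≡q a))
  B⊆ΓA : Γ a - x ⊆ image Γ A
  B⊆ΓA = ∈-image⁺ Γ a∈A ∘ p─q⊆p (Γ a) ⁅ x ⁆

image⊆image─∪ : ∀ {m n} (Γ : Fin m → Subset n) (B : Subset n) (A : Subset m) →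
  image Γ A ⊆ image (λ a → Γ a ─ B) A ∪ B
image⊆image─∪ Γ B A = image-⊆ Γ A λ {a} a∈A {z} z∈Γa → x∈p∪q⁺ (case (z ∈? B) a∈A z∈Γa)
  where
  case : ∀ {a z} → Dec (z ∈ B) → a ∈ A → z ∈ Γ a → z ∈ image (λ a → Γ a ─ B) A ⊎ z ∈ B
  case (yes z∈B) _   _    = inj₂ z∈B
  case (no  z∉B) a∈A z∈Γa = inj₁ (∈-image⁺ (λ a → Γ a ─ B) a∈A (x∈p∧x∉q⇒x∈p─q z∈Γa z∉B))

hyperforest⇒matchings : ∀ {q m n} {Γ : Fin m → Subset n} → q ≥ 1 → Hyperforest q Γ →
  ∀ (B : Subset n) → ∣ B ∣ ≡ q ∸ 1 → SaturatingMatching Γ B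
hyperforest⇒matchings {q} {m} {n} {Γ} q≥1 forest B ∣B∣≡q∸1 =
  as-matching (hall-theorem Γ∖B hallCondition)
  where
  Γ∖B : Fin m → Subset n
  Γ∖B a = Γ a ─ B
  hallCondition : HallCondition Γ∖B
  hallCondition A with nonempty? A
  ... | no  empty    = subst (_≤ ∣ image Γ∖B A ∣) (sym (Empty⇒∣p∣≡0 empty)) z≤n
  ... | yes nonempty = +-cancelʳ-≤ (q ∸ 1) ∣ A ∣ ∣ image Γ∖B A ∣ (begin
    ∣ A ∣ + (q ∸ 1)              ≡⟨ +-∸-assoc ∣ A ∣ q≥1 ⟨
    ∣ A ∣ + q ∸ 1                ≤⟨ forest A nonempty ⟩
    ∣ image Γ A ∣                ≤⟨ p⊆q⇒∣p∣≤∣q∣ (image⊆image─∪ Γ B A) ⟩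
    ∣ image Γ∖B A ∪ B ∣          ≤⟨ ∣p∪q∣≤∣p∣+∣q∣ (image Γ∖B A) B ⟩
    ∣ image Γ∖B A ∣ + ∣ B ∣      ≡⟨ cong (∣ image Γ∖B A ∣ +_) ∣B∣≡q∸1 ⟩
    ∣ image Γ∖B A ∣ + (q ∸ 1)    ∎)
    where open ≤-Reasoning
  as-matching : DistinctRepresentatives Γ∖B → SaturatingMatching Γ B
  as-matching (f , f-inj , f∈Γ∖B) =
    f , f-inj , λ a → p─q⊆p (Γ a) B (f∈Γ∖B a) , x∈p─q⇒x∉q (Γ a) B (f∈Γ∖B a)

theorem1 : (q m n : ℕ) → q ≥ 1 → (Γ : Fin m → Subset n) →
    (∀ a → ∣ Γ a ∣ ≡ q) →
    ((∀ (B : Subset n) → ∣ B ∣ ≡ q ∸ 1 → SaturatingMatching Γ B) →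
      (∀ (A : Subset m) → Nonempty A → ∣ image Γ A ∣ ≥ ∣ A ∣ + q ∸ 1))
    × ((∀ (A : Subset m) → Nonempty A → ∣ image Γ A ∣ ≥ ∣ A ∣ + q ∸ 1) →
      (∀ (B : Subset n) → ∣ B ∣ ≡ q ∸ 1 → SaturatingMatching Γ B))
theorem1 q m n q≥1 Γ ∣Γ∣≡q = matchings⇒hyperforest q≥1 ∣Γ∣≡q , hyperforest⇒matchings q≥1
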